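{- There is an infinite family of instances $\{\mathcal{G}_n\}_{n\in\mathbb{N}}$ (simple temporal graphs with associated parameters $T_{\max}$ and $\delta$) such that the witness complexity under the infection-times-only variation grows in $\Omega(|E(\mathcal{G}_n)|)$, with implied constant independent of the number $k$ of seed infections allowed per round.
   Context: A simple temporal graph $\mathcal{G}=(V,E,\lambda)$ with lifetime $T_{\max}$ has a finite undirected static graph $(V,E)$ and labeling $\lambda:E\to\{1,\dots,T_{\max}\}$. Infection model with parameter $\delta$: all nodes start susceptible; a seed infection $(v,t)$ makes $v$ infected at time $t$; otherwise a susceptible node $u$ becomes infected at time $t$ iff some node $w$ infectious at time $t$ has an edge $uw$ with $\lambda(uw)=t$ (if several, exactly one infects $u$); a node infected at time $t$ is infectious at times $t+1,\dots,t+\delta$ and resistant afterwards. The infection timetable of an infection chain is the set of pairs $(v,t)$ such that $v$ became infected at time $t$. Under the infection-times-only variation, a witnessing schedule of length $a$ for $\mathcal{G}$ is a sequence $S_1,\dots,S_a$ of seed infection sets, each of size at most $k$, such that after performing $a$ rounds with these seed sets on $\mathcal{G}$, all labels of $\mathcal{G}$ are uniquely determined (among labelings of the same static graph) by the resulting infection timetables; the witness complexity is the length of the shortest witnessing schedule. -}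

module Defs where

open import Data.Nat using (ℕ; zero; suc; _+_; _*_; _≤_; _<_; _≡ᵇ_; _<ᵇ_; _≤ᵇ_)
open import Data.Bool using (Bool; true; false; _∧_; _∨_; if_then_else_)
open import Data.Fin using (Fin; toℕ; _≟_)
open import Data.Maybe using (Maybe; just; nothing)
open import Data.Product using (Σ; _×_; _,_; proj₁; proj₂)
open import Data.List using (List; length; allFin)
open import Data.Bool.ListAction using (any)
open import Relation.Nullary.Decidable using (⌊_⌋)
open import Relation.Binary.PropositionalEquality using (_≡_)
open import Function.Definitions using (Injective)

-- A finite simple undirected static graph: vertices Fin nv, edges Fin m,
-- edge e has endpoints (ends e) with the first strictly smaller than the
-- second (no loops, canonical orientation), and distinct edges have
-- distinct endpoint pairs (no multi-edges).
record StaticGraph : Set where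
  field
    nv    : ℕ
    m     : ℕ
    ends  : Fin m → Fin nv × Fin nv
    ordered : ∀ e → toℕ (proj₁ (ends e)) < toℕ (proj₂ (ends e))
    simple  : Injective _≡_ _≡_ ends

open StaticGraph public

numEdges : StaticGraph → ℕ
numEdges g = m g

Labeling : StaticGraph → Set
Labeling g = Fin (m g) → ℕ

ValidLabeling : (g : StaticGraph) → ℕ → Labeling g → Set
ValidLabeling g Tmax lab = ∀ e → 1 ≤ lab e × lab e ≤ Tmax

record Instance : Set where
  field
    graph  : StaticGraph
    Tmax   : ℕ
    δ      : ℕ
    Tmax≥1 : 1 ≤ Tmax
    δ≥1    : 1 ≤ δ
    label  : Labeling graph
    labelValid : ValidLabeling graph Tmax label

open Instance public

-- a seed infection set: list of pairs (v , t); as a set, its size is at most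
-- its length (and every set is represented by a duplicate-free list).
SeedSet : StaticGraph → Set
SeedSet g = List (Fin (nv g) × ℕ)

-- infection status of each node: nothing = susceptible, just s = became
-- infected at time s (afterwards infectious at s+1 … s+δ, then resistant)
Status : StaticGraph → Set
Status g = Fin (nv g) → Maybe ℕ

infectious : ℕ → Maybe ℕ → ℕ → Bool
infectious δ nothing  t = false
infectious δ (just s) t = (s <ᵇ t) ∧ (t ≤ᵇ (s + δ))

seeded : (g : StaticGraph) → SeedSet g → Fin (nv g) → ℕ → Bool
seeded g S v t = any (λ p → ⌊ proj₁ p ≟ v ⌋ ∧ (proj₂ p ≡ᵇ t)) S

exposed : (g : StaticGraph) → ℕ → Labeling g → Status g → Fin (nv g) → ℕ → Bool
exposed g δ lab st v t =
  any (λ e → (lab e ≡ᵇ t) ∧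
             ((⌊ proj₁ (ends g e) ≟ v ⌋ ∧ infectious δ (st (proj₂ (ends g e))) t)
            ∨ (⌊ proj₂ (ends g e) ≟ v ⌋ ∧ infectious δ (st (proj₁ (ends g e))) t)))
      (allFin (m g))

step : (g : StaticGraph) → ℕ → Labeling g → SeedSet g → Status g → ℕ → Status g
step g δ lab S st t v with st v
... | just s  = just s
... | nothing = if seeded g S v t ∨ exposed g δ lab st v t then just t else nothing

statusAfter : (g : StaticGraph) → ℕ → Labeling g → SeedSet g → ℕ → Status g
statusAfter g δ lab S zero    = step g δ lab S (λ _ → nothing) zero
statusAfter g δ lab S (suc t) = step g δ lab S (statusAfter g δ lab S t) (suc t)

inTimetable : (g : StaticGraph) → ℕ → Labeling g → SeedSet g → Fin (nv g) → ℕ → Set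
inTimetable g δ lab S v t = statusAfter g δ lab S t v ≡ just t

-- S_1 … S_a (indexed by Fin a) is a witnessing schedule of length a with at
-- most k seeds per round for instance G, in the infection-times-only
-- variation: every labeling λ' of the same static graph (with the same
-- lifetime) producing the same timetables in all rounds equals λ.
WitnessingSchedule : (G : Instance) → (k a : ℕ) → (Fin a → SeedSet (graph G)) → Set
WitnessingSchedule G k a S =
  (∀ i → length (S i) ≤ k) ×
  (∀ (lab' : Labeling (graph G)) → ValidLabeling (graph G) (Tmax G) lab' →
     (∀ i v t → (inTimetable (graph G) (δ G) (label G) (S i) v t
                  → inTimetable (graph G) (δ G) lab' (S i) v t)
              × (inTimetable (graph G) (δ G) lab' (S i) v t
                  → inTimetable (graph G) (δ G) (label G) (S i) v t)) →
     ∀ e → lab' e ≡ label G e)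

HasWitnessingSchedule : Instance → ℕ → Set
HasWitnessingSchedule G k = Σ ℕ λ a → Σ (Fin a → SeedSet (graph G)) λ S → WitnessingSchedule G k a S

WitnessComplexityAtLeast : Instance → ℕ → ℕ → Set
WitnessComplexityAtLeast G k b = ∀ a (S : Fin a → SeedSet (graph G)) → WitnessingSchedule G k a S → b ≤ a

{-# OPTIONS --safe #-}
module Submission where

-- On the star with M leaves, labels λ(eᵢ) = i + 1 and δ = 1, the round that seeds only the
-- centre at time i infects leaf i at time i + 1 exactly when λ(eᵢ) = i + 1, so M rounds
-- determine the labeling.  Conversely, with δ = 1 an edge transmits only one step after one
-- of its endpoints was infected, and the centre is infected at most once per round, so with
-- the true labels a round notices only the (at most two) edges i for which the centre is
-- infected at time i or i + 1.  If M > 2a + 1, some edge i is noticed by none of a rounds;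
-- relabelling it to y + 1, where y avoids i and the infection times of the centre and of
-- leaf i in every round, changes no timetable.  So every witnessing schedule has length
-- a ≥ (M − 1)/2, whatever k is.

open import Data.Bool using (Bool; true; false; T; _∧_; _∨_)
open import Data.Bool.ListAction using (or)
open import Data.Bool.Properties using (T-∧; T-∨; T-≡; ⇔→≡)
open import Data.Empty using (⊥-elim)
open import Data.Fin using (Fin; zero; suc; toℕ; _≟_)
open import Data.Fin.Properties using (toℕ<n; pigeonhole; ¬∀⟶∃¬)
import Data.Fin.Properties as Fin
open import Data.List using (List; []; _∷_; _++_; length; lookup; tabulate; allFin)
open import Data.List.Membership.Propositional using (_∈_; _∉_; lose)
open import Data.List.Membership.Propositional.Properties using (∈-allFin; ∈-tabulate⁺; ∈-++⁺ˡ; ∈-++⁺ʳ)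
open import Data.List.Properties using (length-++; length-tabulate; map-cong)
open import Data.List.Relation.Unary.Any using (here; there; index; satisfied)
import Data.List.Relation.Unary.Any as Any
open import Data.List.Relation.Unary.Any.Properties using (lookup-index; any⁺; any⁻)
open import Data.Maybe using (Maybe; just; nothing; fromMaybe)
open import Data.Nat
  using (ℕ; suc; pred; _+_; _*_; _≤_; _<_; _≤′_; ≤′-refl; ≤′-step; z≤n; s≤s; _≡ᵇ_; NonZero; >-nonZero⁻¹)
open import Data.Nat.Properties
  using (≡ᵇ⇒≡; ≡⇒≡ᵇ; <ᵇ⇒<; <⇒<ᵇ; ≤ᵇ⇒≤; ≤⇒≤ᵇ; ≤-antisym; ≤-trans; ≤-reflexive; <-trans; <-irrefl;
         <⇒≢; ≤⇒≤′; ≮⇒≥; n<1+n; m≤n+m; +-comm; suc-injective; module ≤-Reasoning)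
open import Data.Nat.Tactic.RingSolver using (solve-∀)
open import Data.List.Membership.DecPropositional Data.Nat._≟_ using (_∈?_)
open import Data.Product using (Σ; ∃; ∃₂; _×_; _,_; proj₁; proj₂)
open import Data.Sum using (_⊎_; inj₁; inj₂; [_,_]′)
open import Data.Sum.Function.Propositional using (_⊎-⇔_)
open import Data.Vec.Functional using (updateAt)
open import Data.Vec.Functional.Properties using (updateAt-updates; updateAt-minimal)
open import Function using (_∘_; const; _⇔_; mk⇔; Equivalence)
import Function.Properties.Equivalence as ⇔
open import Relation.Binary.PropositionalEquality
  using (_≡_; _≢_; refl; sym; trans; cong; cong₂; subst; module ≡-Reasoning)
open import Relation.Nullary using (¬_; yes; no; contradiction)
open import Relation.Nullary.Decidable using (⌊_⌋; fromWitness)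

open import Defs

open Equivalence using (to; from)

T⇔T⇒≡ : ∀ {x y} → T x ⇔ T y → x ≡ y
T⇔T⇒≡ Tx⇔Ty = ⇔→≡ (⇔.trans (⇔.sym T-≡) (⇔.trans Tx⇔Ty T-≡))

∉-below : ∀ {n} (xs : List ℕ) → length xs < n → ∃ λ (i : Fin n) → toℕ i ∉ xs
∉-below {n} xs |xs|<n = ¬∀⟶∃¬ n (λ i → toℕ i ∈ xs) (λ i → toℕ i ∈? xs) all-listed⇒⊥
  where
  all-listed⇒⊥ : ¬ (∀ i → toℕ i ∈ xs)
  all-listed⇒⊥ listed with i , j , i<j , same-index ← pigeonhole |xs|<n (index ∘ listed) =
    <⇒≢ i<j (trans (lookup-index (listed i))
                   (trans (cong (lookup xs) same-index) (sym (lookup-index (listed j)))))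

≤1+a+a⇒≤3*a : ∀ {M} a → 2 ≤ M → M ≤ suc (a + a) → M ≤ 3 * a
≤1+a+a⇒≤3*a 0       2≤M M≤1   = contradiction (≤-trans 2≤M M≤1) λ { (s≤s ()) }
≤1+a+a⇒≤3*a {M} (suc b) _ M≤1+a+a = begin
  M                        ≤⟨ M≤1+a+a ⟩
  suc (suc b + suc b)      ≤⟨ m≤n+m _ b ⟩
  b + suc (suc b + suc b)  ≡⟨ rearrange b ⟩
  3 * suc b                ∎
  where
  open ≤-Reasoning
  rearrange : ∀ b → b + suc (suc b + suc b) ≡ 3 * suc b
  rearrange = solve-∀

infectious-1⇔ : ∀ m t → T (infectious 1 m t) ⇔ ∃ λ s → m ≡ just s × t ≡ suc s
infectious-1⇔ m t = mk⇔ (decode m) encode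
  where
  decode : ∀ m → T (infectious 1 m t) → ∃ λ s → m ≡ just s × t ≡ suc s
  decode (just s) s<t≤s+1 with s<t , t≤s+1 ← T-∧ .to s<t≤s+1 =
    s , refl , ≤-antisym (≤-trans (≤ᵇ⇒≤ t (s + 1) t≤s+1) (≤-reflexive (+-comm s 1))) (<ᵇ⇒< s t s<t)

  encode : (∃ λ s → m ≡ just s × t ≡ suc s) → T (infectious 1 m t)
  encode (s , refl , refl) = T-∧ .from (<⇒<ᵇ (n<1+n s) , ≤⇒≤ᵇ (≤-reflexive (+-comm 1 s)))

module Infection (g : StaticGraph) (δ : ℕ) where

  exposedAlong : Fin (nv g) → ℕ → Fin (nv g) → Maybe ℕ → Bool
  exposedAlong v t a b-status = ⌊ a ≟ v ⌋ ∧ infectious δ b-status t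

  exposedVia : Status g → Fin (nv g) → ℕ → Fin (m g) → Bool
  exposedVia st v t e = exposedAlong v t a (st b) ∨ exposedAlong v t b (st a)
    where
    a b : Fin (nv g)
    a = proj₁ (ends g e)
    b = proj₂ (ends g e)

  exposedAlong⇔ : ∀ v t a b-status →
                  T (exposedAlong v t a b-status) ⇔ (a ≡ v × T (infectious δ b-status t))
  exposedAlong⇔ v t a b-status with a ≟ v
  ... | yes a≡v = mk⇔ (a≡v ,_) proj₂
  ... | no a≢v  = mk⇔ (λ ()) (a≢v ∘ proj₁)

  exposedVia⇔ : ∀ st v t e → T (exposedVia st v t e) ⇔
                  ( proj₁ (ends g e) ≡ v × T (infectious δ (st (proj₂ (ends g e))) t)
                  ⊎ proj₂ (ends g e) ≡ v × T (infectious δ (st (proj₁ (ends g e))) t))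
  exposedVia⇔ st v t e =
    ⇔.trans (T-∨ {exposedAlong v t a (st b)})
            (exposedAlong⇔ v t a (st b) ⊎-⇔ exposedAlong⇔ v t b (st a))
    where
    a b : Fin (nv g)
    a = proj₁ (ends g e)
    b = proj₂ (ends g e)

  Transmits : Labeling g → Status g → Fin (nv g) → ℕ → Fin (m g) → Set
  Transmits L st v t e = L e ≡ t × T (exposedVia st v t e)

  exposed⇔ : ∀ L st v t → T (exposed g δ L st v t) ⇔ ∃ (Transmits L st v t)
  exposed⇔ L st v t = mk⇔ transmitter through
    where
    live : Fin (m g) → Bool
    live e = (L e ≡ᵇ t) ∧ exposedVia st v t e

    transmitter : T (exposed g δ L st v t) → ∃ (Transmits L st v t)
    transmitter ex with e , live-e ← satisfied (any⁻ live (allFin (m g)) ex)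
      with Le≡ᵇt , exposed-e ← T-∧ {L e ≡ᵇ t} .to live-e = e , ≡ᵇ⇒≡ (L e) t Le≡ᵇt , exposed-e

    through : ∃ (Transmits L st v t) → T (exposed g δ L st v t)
    through (e , refl , exposed-e) =
      any⁺ live (lose (∈-allFin e) (T-∧ .from (≡⇒≡ᵇ (L e) (L e) refl , exposed-e)))

  all-susceptible⇒¬exposed : ∀ L st v t → (∀ u → st u ≡ nothing) → ¬ T (exposed g δ L st v t)
  all-susceptible⇒¬exposed L st v t none ex with e , _ , exposed-e ← exposed⇔ L st v t .to ex =
    [ healthy _ ∘ proj₂ , healthy _ ∘ proj₂ ]′ (exposedVia⇔ st v t e .to exposed-e)
    where
    healthy : ∀ u → ¬ T (infectious δ (st u) t)
    healthy u = subst (λ s → ¬ T (infectious δ s t)) (sym (none u)) λ ()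

  seeded⇔ : ∀ S v t → T (seeded g S v t) ⇔ (v , t) ∈ S
  seeded⇔ S v t = mk⇔ (Any.map matches ∘ any⁻ seed S) (any⁺ seed ∘ Any.map matched)
    where
    seed : Fin (nv g) × ℕ → Bool
    seed p = ⌊ proj₁ p ≟ v ⌋ ∧ (proj₂ p ≡ᵇ t)

    matches : ∀ {p} → T (seed p) → (v , t) ≡ p
    matches {w , s} hit with w ≟ v
    ... | yes refl = cong (v ,_) (sym (≡ᵇ⇒≡ s t hit))

    matched : ∀ {p} → (v , t) ≡ p → T (seed p)
    matched refl = T-∧ .from (fromWitness refl , ≡⇒≡ᵇ t t refl)

  statusBefore : Labeling g → SeedSet g → ℕ → Status g
  statusBefore L S 0       = λ _ → nothing
  statusBefore L S (suc t) = statusAfter g δ L S t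

  statusAfter≡step : ∀ L S t v → statusAfter g δ L S t v ≡ step g δ L S (statusBefore L S t) t v
  statusAfter≡step L S 0       v = refl
  statusAfter≡step L S (suc t) v = refl

  module _ (L : Labeling g) (S : SeedSet g) (st : Status g) (t : ℕ) (v : Fin (nv g)) where

    step-infected : ∀ {s} → st v ≡ just s → step g δ L S st t v ≡ just s
    step-infected infected with st v
    ... | just _ = infected

    step-seeded : st v ≡ nothing → T (seeded g S v t) → step g δ L S st t v ≡ just t
    step-seeded susceptible seed with st v
    ... | nothing with seeded g S v t
    ...   | true = refl

    step-exposed : st v ≡ nothing → T (exposed g δ L st v t) → step g δ L S st t v ≡ just t
    step-exposed susceptible ex with st v
    ... | nothing with seeded g S v t | exposed g δ L st v t
    ...   | true  | _    = refl
    ...   | false | true = refl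

    step-unexposed : st v ≡ nothing → ¬ T (seeded g S v t) → ¬ T (exposed g δ L st v t) →
                     step g δ L S st t v ≡ nothing
    step-unexposed susceptible unseeded unexposed with st v
    ... | nothing with seeded g S v t | exposed g δ L st v t
    ...   | true  | _     = contradiction _ unseeded
    ...   | false | true  = contradiction _ unexposed
    ...   | false | false = refl

    step-infects⁻ : ∀ {s} → st v ≡ nothing → step g δ L S st t v ≡ just s →
                    T (seeded g S v t) ⊎ T (exposed g δ L st v t)
    step-infects⁻ susceptible infected with st v
    ... | nothing with seeded g S v t | exposed g δ L st v t
    ...   | true  | _    = inj₁ _
    ...   | false | true = inj₂ _

  step-cong : ∀ {L L′ S st st′ t v} → (∀ u → st u ≡ st′ u) →
              (st v ≡ nothing → exposed g δ L st v t ≡ exposed g δ L′ st′ v t) →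
              step g δ L S st t v ≡ step g δ L′ S st′ t v
  step-cong {st = st} {st′} {v = v} st≗st′ same-exposure with st v | st′ v | st≗st′ v
  ... | just _  | just _  | infected = infected
  ... | nothing | nothing | _ rewrite same-exposure refl = refl

  exposed-cong-status : ∀ {L st st′ v t} → (∀ u → st u ≡ st′ u) →
                        exposed g δ L st v t ≡ exposed g δ L st′ v t
  exposed-cong-status {L} {st} {st′} {v} {t} st≗st′ =
    cong or (map-cong (λ e → cong ((L e ≡ᵇ t) ∧_) (exposedVia-cong e)) (allFin (m g)))
    where
    exposedVia-cong : ∀ e → exposedVia st v t e ≡ exposedVia st′ v t e
    exposedVia-cong e =
      cong₂ (λ x y → exposedAlong v t a x ∨ exposedAlong v t b y) (st≗st′ b) (st≗st′ a)
      where
      a b : Fin (nv g)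
      a = proj₁ (ends g e)
      b = proj₂ (ends g e)

  exposed-cong-labeling : ∀ {L L′ st v t} → (∀ e → Transmits L st v t e ⇔ Transmits L′ st v t e) →
                          exposed g δ L st v t ≡ exposed g δ L′ st v t
  exposed-cong-labeling {L} {L′} {st} {v} {t} same =
    T⇔T⇒≡ (⇔.trans (exposed⇔ L st v t) (⇔.trans same-transmitter (⇔.sym (exposed⇔ L′ st v t))))
    where
    same-transmitter : ∃ (Transmits L st v t) ⇔ ∃ (Transmits L′ st v t)
    same-transmitter = mk⇔ (λ (e , tr) → e , same e .to tr) (λ (e , tr) → e , same e .from tr)

  statusAfter-cong-labeling :
    ∀ {L L′} S →
    (∀ t v → statusBefore L S t v ≡ nothing → ∀ e →
       Transmits L (statusBefore L S t) v t e ⇔ Transmits L′ (statusBefore L S t) v t e) →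
    ∀ t v → statusAfter g δ L S t v ≡ statusAfter g δ L′ S t v
  statusAfter-cong-labeling {L} {L′} S same = after
    where
    before : ∀ t v → statusBefore L S t v ≡ statusBefore L′ S t v
    after  : ∀ t v → statusAfter g δ L S t v ≡ statusAfter g δ L′ S t v

    before 0       v = refl
    before (suc t) v = after t v

    after t v = begin
      statusAfter g δ L S t v                  ≡⟨ statusAfter≡step L S t v ⟩
      step g δ L S (statusBefore L S t) t v    ≡⟨ step-cong (before t) same-exposure ⟩
      step g δ L′ S (statusBefore L′ S t) t v  ≡⟨ statusAfter≡step L′ S t v ⟨
      statusAfter g δ L′ S t v                 ∎
      where
      open ≡-Reasoning
      same-exposure : statusBefore L S t v ≡ nothing →
                      exposed g δ L (statusBefore L S t) v t ≡ exposed g δ L′ (statusBefore L′ S t) v t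
      same-exposure susceptible =
        trans (exposed-cong-labeling {st = statusBefore L S t} (same t v susceptible))
              (exposed-cong-status {L′} (before t))

  statusAfter-mono : ∀ {L S s s′ v u} → s ≤ s′ →
                     statusAfter g δ L S s v ≡ just u → statusAfter g δ L S s′ v ≡ just u
  statusAfter-mono {L} {S} {s} {v = v} {u} s≤s′ = persist (≤⇒≤′ s≤s′)
    where
    persist : ∀ {s′} → s ≤′ s′ → statusAfter g δ L S s v ≡ just u → statusAfter g δ L S s′ v ≡ just u
    persist ≤′-refl            infected = infected
    persist (≤′-step {n} s≤′n) infected =
      step-infected L S (statusAfter g δ L S n) (suc n) v (persist s≤′n infected)

  statusBefore⇒statusAfter : ∀ {L S t v u} →
                             statusBefore L S t v ≡ just u → statusAfter g δ L S t v ≡ just u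
  statusBefore⇒statusAfter {L} {S} {t} {v} infected =
    trans (statusAfter≡step L S t v) (step-infected L S (statusBefore L S t) t v infected)

  susceptible-before-seeds : ∀ L S t → (∀ {t′} v → t′ < t → ¬ T (seeded g S v t′)) →
                             ∀ v → statusBefore L S t v ≡ nothing
  susceptible-before-seeds L S 0       _        v = refl
  susceptible-before-seeds L S (suc t) unseeded v =
    trans (statusAfter≡step L S t v)
          (step-unexposed L S (statusBefore L S t) t v (earlier v) (unseeded v (n<1+n t))
             (all-susceptible⇒¬exposed L _ v t earlier))
    where
    earlier : ∀ v → statusBefore L S t v ≡ nothing
    earlier = susceptible-before-seeds L S t (λ v t′<t → unseeded v (<-trans t′<t (n<1+n t)))

star : ℕ → StaticGraph
star M = record
  { nv      = suc M
  ; m       = M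
  ; ends    = λ e → zero , suc e
  ; ordered = λ _ → s≤s z≤n
  ; simple  = Fin.suc-injective ∘ cong proj₂
  }

centre : ∀ {M} → Fin (nv (star M))
centre = zero

leaf : ∀ {M} → Fin M → Fin (nv (star M))
leaf = suc

starLabel : ∀ M → Labeling (star M)
starLabel M e = suc (toℕ e)

starLabel-valid : ∀ M → ValidLabeling (star M) M (starLabel M)
starLabel-valid M e = s≤s z≤n , toℕ<n e

starInstance : ∀ M → .{{NonZero M}} → Instance
starInstance M = record
  { graph      = star M
  ; Tmax       = M
  ; δ          = 1
  ; Tmax≥1     = >-nonZero⁻¹ M
  ; δ≥1        = s≤s z≤n
  ; label      = starLabel M
  ; labelValid = starLabel-valid M
  }

module _ {M : ℕ} where
  open Infection (star M) 1

  InfectedAcross : Status (star M) → Fin (nv (star M)) → ℕ → Fin M → Set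
  InfectedAcross st v t i =
    ∃ λ s → t ≡ suc s × (v ≡ centre × st (leaf i) ≡ just s ⊎ v ≡ leaf i × st centre ≡ just s)

  exposedVia-star⇔ : ∀ st v t i → T (exposedVia st v t i) ⇔ InfectedAcross st v t i
  exposedVia-star⇔ st v t i = mk⇔ decode encode
    where
    decode : T (exposedVia st v t i) → InfectedAcross st v t i
    decode exposed-i with exposedVia⇔ st v t i .to exposed-i
    ... | inj₁ (refl , infectious-leaf)
      with s , infected , refl ← infectious-1⇔ (st (leaf i)) t .to infectious-leaf =
      s , refl , inj₁ (refl , infected)
    ... | inj₂ (refl , infectious-centre)
      with s , infected , refl ← infectious-1⇔ (st centre) t .to infectious-centre =
      s , refl , inj₂ (refl , infected)

    encode : InfectedAcross st v t i → T (exposedVia st v t i)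
    encode (s , refl , inj₁ (refl , infected)) =
      exposedVia⇔ st v t i .from (inj₁ (refl , infectious-1⇔ (st (leaf i)) t .from (s , infected , refl)))
    encode (s , refl , inj₂ (refl , infected)) =
      exposedVia⇔ st v t i .from (inj₂ (refl , infectious-1⇔ (st centre) t .from (s , infected , refl)))

  probe : ℕ → SeedSet (star M)
  probe J = (centre , J) ∷ []

  probe-leaf-unseeded : ∀ J i t → ¬ T (seeded (star M) (probe J) (leaf i) t)
  probe-leaf-unseeded J i t seed with seeded⇔ (probe J) (leaf i) t .to seed
  ... | here ()
  ... | there ()

  probe-susceptible-before : ∀ L J v → statusBefore L (probe J) J v ≡ nothing
  probe-susceptible-before L J = susceptible-before-seeds L (probe J) J unseeded
    where
    unseeded : ∀ {t} v → t < J → ¬ T (seeded (star M) (probe J) v t)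
    unseeded v t<J seed with seeded⇔ (probe J) v _ .to seed
    ... | here refl = <-irrefl refl t<J

  probe-centre : ∀ L J → statusAfter (star M) 1 L (probe J) J centre ≡ just J
  probe-centre L J =
    trans (statusAfter≡step L (probe J) J centre)
          (step-seeded L (probe J) (statusBefore L (probe J) J) J centre
             (probe-susceptible-before L J centre) (seeded⇔ (probe J) centre J .from (here refl)))

  probe-leaf : ∀ L J i → statusAfter (star M) 1 L (probe J) J (leaf i) ≡ nothing
  probe-leaf L J i =
    trans (statusAfter≡step L (probe J) J (leaf i))
          (step-unexposed L (probe J) (statusBefore L (probe J) J) J (leaf i)
             (probe-susceptible-before L J (leaf i)) (probe-leaf-unseeded J i J)
             (all-susceptible⇒¬exposed L _ (leaf i) J (probe-susceptible-before L J)))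

  probe-reveals : ∀ L J i →
                  statusAfter (star M) 1 L (probe J) (suc J) (leaf i) ≡ just (suc J) ⇔ L i ≡ suc J
  probe-reveals L J i = mk⇔ label-from-infection infection-from-label
    where
    before : Status (star M)
    before = statusAfter (star M) 1 L (probe J) J

    infected-at-1+J : Set
    infected-at-1+J = statusAfter (star M) 1 L (probe J) (suc J) (leaf i) ≡ just (suc J)

    label-from-infection : infected-at-1+J → L i ≡ suc J
    label-from-infection infected
      with step-infects⁻ L (probe J) before (suc J) (leaf i) (probe-leaf L J i) infected
    ... | inj₁ seed = contradiction seed (probe-leaf-unseeded J i (suc J))
    ... | inj₂ ex with e , Le≡1+J , exposed-e ← exposed⇔ L before (leaf i) (suc J) .to ex
                  with exposedVia-star⇔ before (leaf i) (suc J) e .to exposed-e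
    ...   | _ , _ , inj₂ (refl , _) = Le≡1+J

    infection-from-label : L i ≡ suc J → infected-at-1+J
    infection-from-label Li≡1+J =
      step-exposed L (probe J) before (suc J) (leaf i) (probe-leaf L J i)
        (exposed⇔ L before (leaf i) (suc J) .from
           (i , Li≡1+J , exposedVia-star⇔ before (leaf i) (suc J) i .from
                           (J , refl , inj₂ (refl , probe-centre L J))))

  probes-witness : ∀ {k} .{{_ : NonZero M}} → 1 ≤ k →
                   WitnessingSchedule (starInstance M) k M (probe ∘ toℕ)
  probes-witness 1≤k = (λ _ → 1≤k) , λ L _ same-timetables e →
    probe-reveals L (toℕ e) e .to
      (proj₁ (same-timetables e (leaf e) (suc (toℕ e)))
             (probe-reveals (starLabel M) (toℕ e) e .from refl))

  finalStatus : SeedSet (star M) → Status (star M)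
  finalStatus S = statusAfter (star M) 1 (starLabel M) S M

  -- With δ = 1, edge i transmits under its label i + 1 only if the centre is infected at
  -- time i or becomes infected through it at time i + 1, and under label y + 1 only if the
  -- centre or leaf i is infected at time y.
  record Blind (S : SeedSet (star M)) (i y : Fin M) : Set where
    field
      centre≢i   : finalStatus S centre ≢ just (toℕ i)
      centre≢1+i : finalStatus S centre ≢ just (suc (toℕ i))
      centre≢y   : finalStatus S centre ≢ just (toℕ y)
      leaf≢y     : finalStatus S (leaf i) ≢ just (toℕ y)

  relabel : Fin M → Fin M → Labeling (star M)
  relabel i y = updateAt (starLabel M) i (const (suc (toℕ y)))

  relabel-valid : ∀ i y → ValidLabeling (star M) M (relabel i y)
  relabel-valid i y e with e ≟ i
  ... | yes refl =
    subst (λ ℓ → 1 ≤ ℓ × ℓ ≤ M) (sym (updateAt-updates i (starLabel M))) (s≤s z≤n , toℕ<n y)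
  ... | no e≢i   =
    subst (λ ℓ → 1 ≤ ℓ × ℓ ≤ M) (sym (updateAt-minimal e i (starLabel M) e≢i)) (starLabel-valid M e)

  relabel-preserves-statusAfter :
    ∀ {S i y} → Blind S i y →
    ∀ t v → statusAfter (star M) 1 (starLabel M) S t v ≡ statusAfter (star M) 1 (relabel i y) S t v
  relabel-preserves-statusAfter {S} {i} {y} blind = statusAfter-cong-labeling S same-transmissions
    where
    open Blind blind

    before : ℕ → Status (star M)
    before = statusBefore (starLabel M) S

    final-from-before : ∀ {t w s} → t ≤ M → before t w ≡ just s → finalStatus S w ≡ just s
    final-from-before {t} {w} t≤M infected =
      statusAfter-mono t≤M (statusBefore⇒statusAfter {starLabel M} {S} {t} {w} infected)

    old-silent : ∀ t v → before t v ≡ nothing → ¬ Transmits (starLabel M) (before t) v t i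
    old-silent t v susceptible (refl , exposed-i) with exposedVia-star⇔ (before t) v t i .to exposed-i
    ... | _ , refl , inj₁ (refl , _) = centre≢1+i (statusAfter-mono (toℕ<n i) centre-infected)
      where
      centre-infected : statusAfter (star M) 1 (starLabel M) S t centre ≡ just t
      centre-infected =
        trans (statusAfter≡step (starLabel M) S t centre)
              (step-exposed (starLabel M) S (before t) t centre susceptible
                 (exposed⇔ (starLabel M) (before t) centre t .from (i , refl , exposed-i)))
    ... | _ , refl , inj₂ (refl , centre-infected) = centre≢i (final-from-before (toℕ<n i) centre-infected)

    new-silent : ∀ t v → before t v ≡ nothing → ¬ Transmits (relabel i y) (before t) v t i
    new-silent t v _ (label≡t , exposed-i) with trans (sym (updateAt-updates i (starLabel M))) label≡t
    ... | refl with exposedVia-star⇔ (before t) v t i .to exposed-i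
    ...   | _ , refl , inj₁ (refl , leaf-infected)   = leaf≢y (final-from-before (toℕ<n y) leaf-infected)
    ...   | _ , refl , inj₂ (refl , centre-infected) = centre≢y (final-from-before (toℕ<n y) centre-infected)

    same-transmissions :
      ∀ t v → before t v ≡ nothing → ∀ e →
      Transmits (starLabel M) (before t) v t e ⇔ Transmits (relabel i y) (before t) v t e
    same-transmissions t v susceptible e with e ≟ i
    ... | yes refl = mk⇔ (⊥-elim ∘ old-silent t v susceptible) (⊥-elim ∘ new-silent t v susceptible)
    ... | no e≢i = mk⇔ (λ (same , exposed-e) → trans unchanged same , exposed-e)
                       (λ (same , exposed-e) → trans (sym unchanged) same , exposed-e)
      where
      unchanged : relabel i y e ≡ starLabel M e
      unchanged = updateAt-minimal e i (starLabel M) e≢i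

  ∃blind-relabeling : ∀ {a} (S : Fin a → SeedSet (star M)) → suc (a + a) < M →
                      ∃₂ λ i y → toℕ y ≢ toℕ i × ∀ r → Blind (S r) i y
  ∃blind-relabeling {a} S 1+a+a<M = i , y , y∉ ∘ here , blind
    where
    -- An uninfected node gets time 0; this only forbids one more, spurious, value.
    time : Maybe ℕ → ℕ
    time = fromMaybe 0

    centreTime : Fin a → ℕ
    centreTime r = time (finalStatus (S r) centre)

    leafTime : Fin M → Fin a → ℕ
    leafTime i r = time (finalStatus (S r) (leaf i))

    length-two-per-round : ∀ f g → length (tabulate f ++ tabulate g) ≡ a + a
    length-two-per-round f g =
      trans (length-++ (tabulate f)) (cong₂ _+_ (length-tabulate f) (length-tabulate g))

    listed : ∀ {f : Fin a → ℕ} {s} r → f r ≡ s → s ∈ tabulate f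
    listed r refl = ∈-tabulate⁺ r

    i-choice : ∃ λ (i : Fin M) → toℕ i ∉ tabulate centreTime ++ tabulate (pred ∘ centreTime)
    i-choice = ∉-below _ (subst (_< M) (sym (length-two-per-round centreTime (pred ∘ centreTime)))
                                (<-trans (n<1+n (a + a)) 1+a+a<M))

    i : Fin M
    i = proj₁ i-choice

    y-choice : ∃ λ (y : Fin M) → toℕ y ∉ toℕ i ∷ tabulate centreTime ++ tabulate (leafTime i)
    y-choice = ∉-below _ (subst (_< M) (cong suc (sym (length-two-per-round centreTime (leafTime i))))
                                1+a+a<M)

    y : Fin M
    y = proj₁ y-choice

    y∉ : toℕ y ∉ toℕ i ∷ tabulate centreTime ++ tabulate (leafTime i)
    y∉ = proj₂ y-choice

    blind : ∀ r → Blind (S r) i y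
    blind r = record
      { centre≢i   = λ infected → proj₂ i-choice (∈-++⁺ˡ (listed r (cong time infected)))
      ; centre≢1+i = λ infected → proj₂ i-choice (∈-++⁺ʳ _ (listed r (cong (pred ∘ time) infected)))
      ; centre≢y   = λ infected → y∉ (there (∈-++⁺ˡ (listed r (cong time infected))))
      ; leaf≢y     = λ infected → y∉ (there (∈-++⁺ʳ _ (listed r (cong time infected))))
      }

  witnessing⇒M≤1+a+a : ∀ {k a S} .{{_ : NonZero M}} →
                       WitnessingSchedule (starInstance M) k a S → M ≤ suc (a + a)
  witnessing⇒M≤1+a+a {S = S} (_ , determined) = ≮⇒≥ λ 1+a+a<M →
    let i , y , y≢i , blind = ∃blind-relabeling S 1+a+a<M
        relabel-undetected : relabel i y i ≡ starLabel M i
        relabel-undetected =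
          determined (relabel i y) (relabel-valid i y)
            (λ r v t → let same = relabel-preserves-statusAfter (blind r) t v
                       in trans (sym same) , trans same)
            i
    in y≢i (suc-injective (trans (sym (updateAt-updates i (starLabel M))) relabel-undetected))

corollary4 : Σ (ℕ → Instance) λ G →
               (∀ n → n ≤ numEdges (graph (G n))) ×
               Σ ℕ λ C → Σ ℕ λ N →
                 ∀ k → 1 ≤ k → ∀ n → N ≤ n →
                   HasWitnessingSchedule (G n) k ×
                   (∀ a (S : _) → WitnessingSchedule (G n) k a S → numEdges (graph (G n)) ≤ C * a)
corollary4 = (λ n → starInstance (2 + n)) , (λ n → m≤n+m n 2) , 3 , 0 , λ k 1≤k n _ →
  (2 + n , probe ∘ toℕ , probes-witness 1≤k) ,
  λ a _ witnessing → ≤1+a+a⇒≤3*a a (s≤s (s≤s z≤n)) (witnessing⇒M≤1+a+a witnessing)
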